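{- Let $R \in \mathrm{IRel}_m$, $S \in \mathrm{IRel}_n$ and $T \in \mathrm{IRel}_{m+n}$. Then the following are equivalent: (1) $T \in \mathrm{Sh}(R,S)$; (2) $T_{[m]} = R$ and $T_{\{m+1,\dots,m+n\}} = S$; (3) $\mathrm{U}(R,S) \le T \le \mathrm{O}(R,S)$ in the weak order on $\mathrm{IRel}_{m+n}$.
   Context: For $n \ge 0$ let $[n]=\{1,\dots,n\}$. An integer relation of size $n$ is a reflexive binary relation $R \subseteq [n]^2$ (it always contains all pairs $(i,i)$); $\mathrm{IRel}_n$ denotes the set of these. For $R \in \mathrm{IRel}_n$ and $X=\{x_1<\dots<x_k\}\subseteq [n]$, the restriction $R_X \in \mathrm{IRel}_k$ is $\{(i,j)\in[k]^2 : (x_i,x_j)\in R\}$. Write $\mathrm{Inc}(R)=\{(a,b)\in R: a\le b\}$ and $\mathrm{Dec}(R)=\{(b,a)\in R : a\le b\}$. The weak order on $\mathrm{IRel}_n$ is: $R \le S$ iff $\mathrm{Inc}(R)\supseteq \mathrm{Inc}(S)$ and $\mathrm{Dec}(R)\subseteq\mathrm{Dec}(S)$. For $S\in\mathrm{IRel}_n$ and $m\ge 0$, let $\overline{S}=\{(m+i,m+j):(i,j)\in S\}$ and $\overline{[n]}=\{m+1,\dots,m+n\}$. For $R\in\mathrm{IRel}_m$, $S\in\mathrm{IRel}_n$ define $\mathrm{U}(R,S)=R\cup\overline{S}\cup([m]\times\overline{[n]})$ and $\mathrm{O}(R,S)=R\cup\overline{S}\cup(\overline{[n]}\times[m])$,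 both in $\mathrm{IRel}_{m+n}$. The shifted shuffle $\mathrm{Sh}(R,S)$ is the set of all relations $R\cup\overline{S}\cup I\cup D$ with $I\subseteq [m]\times\overline{[n]}$ and $D\subseteq \overline{[n]}\times[m]$. -}

module Defs where

open import Data.Nat using (ℕ; _+_)
open import Data.Bool using (Bool; true; false; _∨_)
open import Data.Fin using (Fin; _↑ˡ_; _↑ʳ_; splitAt) renaming (_≤_ to _≤ᶠ_)
open import Data.Sum using (_⊎_; inj₁; inj₂)
open import Data.Product using (Σ; _×_)
open import Relation.Binary.PropositionalEquality using (_≡_)

record IRel (n : ℕ) : Set where
  field
    rel  : Fin n → Fin n → Bool
    reflexive : ∀ i → rel i i ≡ true
open IRel public

_∋_,_ : ∀ {n} → IRel n → Fin n → Fin n → Set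
R ∋ a , b = rel R a b ≡ true

_≐_ : ∀ {n} → IRel n → IRel n → Set
R ≐ S = ∀ a b → rel R a b ≡ rel S a b

restrictLeft : ∀ m n → IRel (m + n) → IRel m
rel (restrictLeft m n T) i j = rel T (i ↑ˡ n) (j ↑ˡ n)
reflexive (restrictLeft m n T) i = reflexive T (i ↑ˡ n)

restrictRight : ∀ m n → IRel (m + n) → IRel n
rel (restrictRight m n T) i j = rel T (m ↑ʳ i) (m ↑ʳ j)
reflexive (restrictRight m n T) i = reflexive T (m ↑ʳ i)

-- Weak order: R ≤ S iff Inc(R) ⊇ Inc(S) and Dec(R) ⊆ Dec(S).
_≤w_ : ∀ {n} → IRel n → IRel n → Set
R ≤w S = (∀ a b → a ≤ᶠ b → S ∋ a , b → R ∋ a , b)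
       × (∀ a b → a ≤ᶠ b → R ∋ b , a → S ∋ b , a)

-- Generic gluing: R ∪ S̄ ∪ {(i, m+j) | I i j} ∪ {(m+j, i) | D j i}
glue : ∀ {m n} → IRel m → IRel n → (Fin m → Fin n → Bool) → (Fin n → Fin m → Bool)
     → Fin (m + n) → Fin (m + n) → Bool
glue {m} {n} R S I D a b with splitAt m a | splitAt m b
... | inj₁ i | inj₁ j = rel R i j
... | inj₂ i | inj₂ j = rel S i j
... | inj₁ i | inj₂ j = I i j
... | inj₂ j | inj₁ i = D j i

glue-refl : ∀ {m n} (R : IRel m) (S : IRel n) I D a → glue R S I D a a ≡ true
glue-refl {m} R S I D a with splitAt m a
... | inj₁ i = reflexive R i
... | inj₂ i = reflexive S i

glueRel : ∀ {m n} → IRel m → IRel n → (Fin m → Fin n → Bool) → (Fin n → Fin m → Bool)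
        → IRel (m + n)
rel (glueRel R S I D) = glue R S I D
reflexive (glueRel R S I D) = glue-refl R S I D

U : ∀ {m n} → IRel m → IRel n → IRel (m + n)
U R S = glueRel R S (λ _ _ → true) (λ _ _ → false)

O : ∀ {m n} → IRel m → IRel n → IRel (m + n)
O R S = glueRel R S (λ _ _ → false) (λ _ _ → true)

_∈Sh[_,_] : ∀ {m n} → IRel (m + n) → IRel m → IRel n → Set
T ∈Sh[ R , S ] = Σ _ λ I → Σ _ λ D → T ≐ glueRel R S I D

module Submission where

-- Split Fin (m + n) into its left block (images i ↑ˡ n) and its
-- right block (images m ↑ʳ j).  A relation on Fin (m + n) is then described by
-- four blocks: the two diagonal ones (restrictions) and two off-diagonal ones
-- (the I and D of a shifted shuffle).
--   (1) ⇔ (2): a glued relation glueRel R S I D restricts to R and S; conversely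
--     every T equals the gluing of its own four blocks.
--   (2) ⇒ (3): two gluings with the same diagonal blocks are compared in the weak
--     order blockwise on the off-diagonal parts, because every left point lies
--     below every right point; U has the largest I and the smallest D, O the
--     reverse.
--   (3) ⇒ (2): a sandwich lemma — if A ≤w T ≤w B and A, B agree on a pair, then T
--     agrees with them there; U and O agree on both diagonal blocks.

open import Defs
open import Data.Nat using (ℕ; _+_)
open import Data.Product using (_×_; _,_)
open import Function.Bundles using (_⇔_; mk⇔)

open import Data.Sum using (_⊎_; inj₁; inj₂)
open import Data.Bool using (Bool; true; false)
open import Data.Empty using (⊥; ⊥-elim)
open import Data.Fin using (Fin; _↑ˡ_; _↑ʳ_; splitAt; join) renaming (_≤_ to _≤ᶠ_)
open import Data.Fin.Properties
  using (splitAt-↑ˡ; splitAt-↑ʳ; join-splitAt; toℕ-↑ˡ; toℕ-↑ʳ; toℕ<n)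
  renaming (≤-total to ≤ᶠ-total)
open import Data.Nat.Properties using (<-≤-trans; m≤m+n; <⇒≱)
open import Relation.Binary.PropositionalEquality using (_≡_; refl; sym; trans; subst)

bool-ext : ∀ {b c : Bool} → (b ≡ true → c ≡ true) → (c ≡ true → b ≡ true) → b ≡ c
bool-ext {false} {false} _ _ = refl
bool-ext {false} {true}  _ g = g refl
bool-ext {true}  {false} f _ = sym (f refl)
bool-ext {true}  {true}  _ _ = refl

data Block (m n : ℕ) : Fin (m + n) → Set where
  left  : (i : Fin m) → Block m n (i ↑ˡ n)
  right : (j : Fin n) → Block m n (m ↑ʳ j)

block : ∀ m n (a : Fin (m + n)) → Block m n a
block m n a = subst (Block m n) (join-splitAt m n a) (fromSplit (splitAt m a))
  where
  fromSplit : (s : Fin m ⊎ Fin n) → Block m n (join m n s)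
  fromSplit (inj₁ i) = left i
  fromSplit (inj₂ j) = right j

right≰left : ∀ {m n} (j : Fin n) (i : Fin m) → (m ↑ʳ j) ≤ᶠ (i ↑ˡ n) → ⊥
right≰left {m} {n} j i le rewrite toℕ-↑ˡ i n | toℕ-↑ʳ m j =
  <⇒≱ (<-≤-trans (toℕ<n i) (m≤m+n m _)) le

module GlueBlocks {m n : ℕ} (R : IRel m) (S : IRel n)
                  (I : Fin m → Fin n → Bool) (D : Fin n → Fin m → Bool) where
  glue-ll : ∀ i j → glue R S I D (i ↑ˡ n) (j ↑ˡ n) ≡ rel R i j
  glue-ll i j rewrite splitAt-↑ˡ m i n | splitAt-↑ˡ m j n = refl

  glue-rr : ∀ i j → glue R S I D (m ↑ʳ i) (m ↑ʳ j) ≡ rel S i j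
  glue-rr i j rewrite splitAt-↑ʳ m n i | splitAt-↑ʳ m n j = refl

  glue-lr : ∀ i j → glue R S I D (i ↑ˡ n) (m ↑ʳ j) ≡ I i j
  glue-lr i j rewrite splitAt-↑ˡ m i n | splitAt-↑ʳ m n j = refl

  glue-rl : ∀ j i → glue R S I D (m ↑ʳ j) (i ↑ˡ n) ≡ D j i
  glue-rl j i rewrite splitAt-↑ˡ m i n | splitAt-↑ʳ m n j = refl

open GlueBlocks

glue-restricts : ∀ {m n} (R : IRel m) (S : IRel n) I D
  → (restrictLeft m n (glueRel R S I D) ≐ R) × (restrictRight m n (glueRel R S I D) ≐ S)
glue-restricts R S I D = glue-ll R S I D , glue-rr R S I D

upperBlock : ∀ {m n} → IRel (m + n) → Fin m → Fin n → Bool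
upperBlock {m} {n} T i j = rel T (i ↑ˡ n) (m ↑ʳ j)

lowerBlock : ∀ {m n} → IRel (m + n) → Fin n → Fin m → Bool
lowerBlock {m} {n} T j i = rel T (m ↑ʳ j) (i ↑ˡ n)

glue-ofBlocks : ∀ {m n} (R : IRel m) (S : IRel n) (T : IRel (m + n))
  → restrictLeft m n T ≐ R → restrictRight m n T ≐ S
  → T ≐ glueRel R S (upperBlock T) (lowerBlock T)
glue-ofBlocks {m} {n} R S T eqL eqR a b with block m n a | block m n b
... | left i  | left j  = trans (eqL i j) (sym (glue-ll R S _ _ i j))
... | left i  | right j = sym (glue-lr R S _ _ i j)
... | right j | left i  = sym (glue-rl R S _ _ j i)
... | right i | right j = trans (eqR i j) (sym (glue-rr R S _ _ i j))

≤w-resp-≐ : ∀ {N} {A A′ B B′ : IRel N} → A ≐ A′ → B ≐ B′ → A ≤w B → A′ ≤w B′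
≤w-resp-≐ eqA eqB (inc , dec) =
    (λ a b le t → trans (sym (eqA a b)) (inc a b le (trans (eqB a b) t)))
  , (λ a b le t → trans (sym (eqB b a)) (dec a b le (trans (eqA b a) t)))

glue-≤w : ∀ {m n} (R : IRel m) (S : IRel n) {I I′ : Fin m → Fin n → Bool} {D D′ : Fin n → Fin m → Bool}
  → (∀ i j → I′ i j ≡ true → I i j ≡ true)
  → (∀ j i → D j i ≡ true → D′ j i ≡ true)
  → glueRel R S I D ≤w glueRel R S I′ D′
glue-≤w {m} {n} R S {I} {I′} {D} {D′} I′⊆I D⊆D′ = inc , dec
  where
  inc : ∀ a b → a ≤ᶠ b → glueRel R S I′ D′ ∋ a , b → glueRel R S I D ∋ a , b
  inc a b le t with block m n a | block m n b
  ... | left i  | left j  = trans (glue-ll R S I D i j) (trans (sym (glue-ll R S I′ D′ i j)) t)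
  ... | left i  | right j = trans (glue-lr R S I D i j) (I′⊆I i j (trans (sym (glue-lr R S I′ D′ i j)) t))
  ... | right j | left i  = ⊥-elim (right≰left j i le)
  ... | right i | right j = trans (glue-rr R S I D i j) (trans (sym (glue-rr R S I′ D′ i j)) t)

  dec : ∀ a b → a ≤ᶠ b → glueRel R S I D ∋ b , a → glueRel R S I′ D′ ∋ b , a
  dec a b le t with block m n a | block m n b
  ... | left i  | left j  = trans (glue-ll R S I′ D′ j i) (trans (sym (glue-ll R S I D j i)) t)
  ... | left i  | right j = trans (glue-rl R S I′ D′ j i) (D⊆D′ j i (trans (sym (glue-rl R S I D j i)) t))
  ... | right j | left i  = ⊥-elim (right≰left j i le)
  ... | right i | right j = trans (glue-rr R S I′ D′ j i) (trans (sym (glue-rr R S I D j i)) t)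

shuffle-between : ∀ {m n} (R : IRel m) (S : IRel n) (T : IRel (m + n))
  → restrictLeft m n T ≐ R → restrictRight m n T ≐ S
  → (U R S ≤w T) × (T ≤w O R S)
shuffle-between R S T eqL eqR = U≤T , T≤O
  where
  Tᵍ : IRel _
  Tᵍ = glueRel R S (upperBlock T) (lowerBlock T)

  Tᵍ≐T : Tᵍ ≐ T
  Tᵍ≐T a b = sym (glue-ofBlocks R S T eqL eqR a b)

  U≤T : U R S ≤w T
  U≤T = ≤w-resp-≐ {A = U R S} {U R S} {Tᵍ} {T} (λ _ _ → refl) Tᵍ≐T
                  (glue-≤w R S (λ _ _ _ → refl) (λ _ _ ()))

  T≤O : T ≤w O R S
  T≤O = ≤w-resp-≐ {A = Tᵍ} {T} {O R S} {O R S} Tᵍ≐T (λ _ _ → refl)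
                  (glue-≤w R S (λ _ _ ()) (λ _ _ _ → refl))

≤w-sandwich : ∀ {N} {A T B : IRel N} → A ≤w T → T ≤w B
  → ∀ a b → rel A a b ≡ rel B a b → rel T a b ≡ rel A a b
≤w-sandwich (incAT , decAT) (incTB , decTB) a b A≡B with ≤ᶠ-total a b
... | inj₁ a≤b = bool-ext (incAT a b a≤b) (λ t → incTB a b a≤b (trans (sym A≡B) t))
... | inj₂ b≤a = bool-ext (λ t → trans A≡B (decTB b a b≤a t)) (decAT b a b≤a)

between-restricts : ∀ {m n} (R : IRel m) (S : IRel n) (T : IRel (m + n))
  → U R S ≤w T → T ≤w O R S
  → (restrictLeft m n T ≐ R) × (restrictRight m n T ≐ S)
between-restricts {m} {n} R S T U≤T T≤O =
    (λ i j → squeeze (i ↑ˡ n) (j ↑ˡ n) (glue-ll R S _ _ i j) (glue-ll R S _ _ i j))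
  , (λ i j → squeeze (m ↑ʳ i) (m ↑ʳ j) (glue-rr R S _ _ i j) (glue-rr R S _ _ i j))
  where
  squeeze : ∀ a b {r : Bool} → rel (U R S) a b ≡ r → rel (O R S) a b ≡ r → rel T a b ≡ r
  squeeze a b U≡r O≡r =
    trans (≤w-sandwich {A = U R S} {T} {O R S} U≤T T≤O a b (trans U≡r (sym O≡r))) U≡r

mainTheorem1 : ∀ (m n : ℕ) (R : IRel m) (S : IRel n) (T : IRel (m + n))
    → ((T ∈Sh[ R , S ]) ⇔ ((restrictLeft m n T ≐ R) × (restrictRight m n T ≐ S)))
    × (((restrictLeft m n T ≐ R) × (restrictRight m n T ≐ S)) ⇔ ((U R S ≤w T) × (T ≤w O R S)))
mainTheorem1 m n R S T =
    mk⇔ shuffle⇒restricts restricts⇒shuffle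
  , mk⇔ (λ (eqL , eqR) → shuffle-between R S T eqL eqR)
        (λ (U≤T , T≤O) → between-restricts R S T U≤T T≤O)
  where
  shuffle⇒restricts : T ∈Sh[ R , S ] → (restrictLeft m n T ≐ R) × (restrictRight m n T ≐ S)
  shuffle⇒restricts (I , D , T≐glue) =
    let (glueL , glueR) = glue-restricts R S I D
    in (λ i j → trans (T≐glue _ _) (glueL i j)) , (λ i j → trans (T≐glue _ _) (glueR i j))

  restricts⇒shuffle : (restrictLeft m n T ≐ R) × (restrictRight m n T ≐ S) → T ∈Sh[ R , S ]
  restricts⇒shuffle (eqL , eqR) = upperBlock T , lowerBlock T , glue-ofBlocks R S T eqL eqR
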